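{- For $n\ge 3$ let $m=\binom{n}{3}$ and let $G_n$ be the graph obtained from an edgeless graph on a vertex set $W$ with $|W|=n$ and a complete graph $K_m$ whose vertices are in bijection with the $3$-element subsets of $W$, by joining each vertex of $K_m$ to exactly the three vertices of its corresponding $3$-element subset of $W$. Then $\bar{\gamma}_R(G_n)=2$ and $\gamma_R(G_n)\ge \tfrac{2}{3}n$. In particular, the ratio $\gamma_R(G)/\bar{\gamma}_R(G)$ is unbounded over connected graphs $G$.
   Context: For a graph $G$ and vertex $v$, $N[v]$ is the closed neighbourhood of $v$. A Roman dominating function of $G$ is a map $f\colon V(G)\to\{0,1,2\}$ such that every $v$ with $f(v)=0$ has a neighbour $u$ with $f(u)=2$; $\gamma_R(G)$ is the minimum of $\sum_v f(v)$ over such $f$. A two neighbour packing of $G$ is a set $A\subseteq V(G)$ with $|N[v]\cap A|\le 2$ for all $v\in V(G)$; $\bar{\gamma}_R(G)$ is the maximum size of a two neighbour packing of $G$. -}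

module Defs where

open import Level using (0ℓ)
open import Data.Nat using (ℕ; _≤_; _*_; _<_)
open import Data.Fin using (Fin)
open import Data.Fin.Subset using (Subset; _∈_; ∣_∣)
open import Data.List using (List; length; filter; map)
open import Data.Nat.ListAction using (sum)
open import Data.List.Relation.Unary.Unique.Propositional using (Unique)
import Data.List.Membership.Propositional as LM
open import Data.Product using (Σ; ∃; _×_; proj₁)
open import Data.Sum using (_⊎_; inj₁; inj₂)
open import Data.Empty using (⊥)
open import Relation.Nullary using (¬_)
open import Relation.Nullary.Decidable using (_⊎-dec_)
open import Relation.Binary using (Decidable; DecidableEquality)
open import Relation.Binary.PropositionalEquality using (_≡_)

record Graph : Set₁ where
  field
    V       : Set
    _≟V_    : DecidableEquality V
    Adj     : V → V → Set
    adj?    : Decidable Adj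
    sym     : ∀ {u v} → Adj u v → Adj v u
    irrefl  : ∀ {v} → ¬ Adj v v
    verts   : List V
    verts-complete : ∀ v → v LM.∈ verts
    verts-unique   : Unique verts

module _ (G : Graph) where
  open Graph G

  InClosedNbhd : V → V → Set
  InClosedNbhd v u = (u ≡ v) ⊎ Adj v u

  inClosedNbhd? : (v : V) → (u : V) → _
  inClosedNbhd? v u = (u ≟V v) ⊎-dec adj? v u

  IsRDF : (V → ℕ) → Set
  IsRDF f = (∀ v → f v ≤ 2) × (∀ v → f v ≡ 0 → ∃ λ u → Adj v u × f u ≡ 2)

  weight : (V → ℕ) → ℕ
  weight f = sum (map f verts)

  IsRomanDominationNumber : ℕ → Set
  IsRomanDominationNumber r =
    (∃ λ f → IsRDF f × weight f ≡ r) × (∀ f → IsRDF f → r ≤ weight f)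

  IsTwoNeighbourPacking : List V → Set
  IsTwoNeighbourPacking A =
    Unique A × (∀ v → length (filter (inClosedNbhd? v) A) ≤ 2)

  IsTwoNeighbourPackingNumber : ℕ → Set
  IsTwoNeighbourPackingNumber p =
    (∃ λ A → IsTwoNeighbourPacking A × length A ≡ p)
    × (∀ A → IsTwoNeighbourPacking A → length A ≤ p)

  data Reachable : V → V → Set where
    here : ∀ {v} → Reachable v v
    step : ∀ {u w v} → Adj u w → Reachable w v → Reachable u v

  Connected : Set
  Connected = ∀ u v → Reachable u v

Triple : ℕ → Set
Triple n = Σ (Subset n) (λ s → ∣ s ∣ ≡ 3)

-- vertex set of G_n : W ⊎ (vertices of K_m, identified with the 3-subsets)
GnV : ℕ → Set
GnV n = Fin n ⊎ Triple n

GnAdj : (n : ℕ) → GnV n → GnV n → Set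
GnAdj n (inj₁ w) (inj₁ w') = ⊥
GnAdj n (inj₁ w) (inj₂ t)  = w ∈ proj₁ t
GnAdj n (inj₂ t) (inj₁ w)  = w ∈ proj₁ t
GnAdj n (inj₂ s) (inj₂ t)  = ¬ (proj₁ s ≡ proj₁ t)

module Submission where

-- Any three vertices of G_n lie in the closed neighbourhood of one vertex of K_m, namely of a
-- 3-subset of W containing the W-vertices among them; so a two neighbour packing has at most two
-- elements, and two vertices of W form one.  If f is a Roman dominating function, every w ∈ W
-- with f w = 0 lies in a triple t with f t = 2, and such a triple covers only three vertices of W.
-- With z zeros on W and j twos on K_m this gives n ≤ f(W) + z, z ≤ 3j and 2j ≤ f(K_m), hence
-- 2n ≤ 3 f(V).  For n = 3(c + 1) this yields γ_R(G_n) > 2c = c · γ̄_R(G_n).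

open import Defs
open import Level using (0ℓ)
open import Data.Nat using (ℕ; zero; suc; _+_; _*_; _≤_; _<_; z≤n; s≤s; _≤?_; _≟_)
open import Data.Nat.Properties
  using ( ≤-refl; ≤-reflexive; ≤-trans; ≤-antisym; ≰⇒>; <⇒≱; n<1+n; n≢0⇒n>0; m≤n+m; m≤m*n
        ; ≡-irrelevant; +-suc; +-assoc; +-mono-≤; +-monoʳ-≤; *-zeroʳ; *-identityʳ; *-suc
        ; *-comm; *-assoc; *-distribˡ-+; *-monoˡ-≤; *-monoʳ-≤; *-monoʳ-<; *-cancelˡ-≤
        ; module ≤-Reasoning )
open import Data.Nat.ListAction using (sum)
open import Data.Nat.ListAction.Properties using (sum-++; sum-↭)
open import Data.Bool using () renaming (_≟_ to _≟Bool_)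
open import Data.Fin using (Fin)
import Data.Fin as Fin
open import Data.Fin.Subset
  using (Subset; inside; outside; ⊥; ⊤; ⁅_⁆; _∪_; _-_; ⋃; ∣_∣; _⊆_) renaming (_∈_ to _∈ˢ_)
open import Data.Fin.Subset.Properties
  using ( ∣⊥∣≡0; ∣⊤∣≡n; ∣⁅x⁆∣≡1; ∣p∣≤∣x∷p∣; x∈⁅x⁆; _∈?_; ⊆⊤; ⊆-trans; s⊆s; p⊆p∪q; q⊆p∪q
        ; x∈p∧x≢y⇒x∈p-y; x∈p⇒∣p-x∣<∣p∣ )
open import Data.Vec using ([]; _∷_)
open import Data.Vec.Properties using (∷-injective; ≡-dec)
open import Data.List
  using (List; []; _∷_; length; filter; map; allFin; upTo; _++_; cartesianProductWith)
open import Data.List.Properties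
  using (filter-accept; filter-reject; length-filter; map-cong; map-∘; map-++; length-tabulate)
open import Data.List.Extrema.Nat using (argmin; argmin-all; f[argmin]≤f[xs])
open import Data.List.Membership.Propositional using (_∈_; lose)
open import Data.List.Membership.Propositional.Properties
  using ( ∈-map⁺; ∈-map⁻; ∈-++⁺ˡ; ∈-++⁺ʳ; ∈-allFin; ∈-upTo⁺; ∈-filter⁺; ∈-filter⁻
        ; ∈-cartesianProductWith⁺ )
open import Data.List.Membership.Propositional.Properties.WithK using (unique∧set⇒bag)
open import Data.List.Relation.Binary.BagAndSetEquality using (∼bag⇒↭)
import Data.List.Relation.Binary.Permutation.Propositional.Properties as Permutation
open import Data.List.Relation.Unary.All using (All; []; _∷_; all?)
import Data.List.Relation.Unary.All as All
open import Data.List.Relation.Unary.All.Properties using (all-filter) renaming (map⁻ to All-map⁻)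
open import Data.List.Relation.Unary.Any using (here; there; any?; satisfied)
open import Data.List.Relation.Unary.Unique.Propositional using (Unique; []; _∷_)
open import Data.List.Relation.Unary.Unique.Propositional.Properties
  using (map⁺; map⁻; ++⁺; allFin⁺; filter⁺; cartesianProductWith⁺)
open import Data.Product using (Σ; ∃; _×_; _,_; proj₁; proj₂)
open import Data.Sum using (inj₁; inj₂)
open import Data.Sum.Properties
  using (inj₁-injective; inj₂-injective) renaming (≡-dec to ≡-dec-⊎)
open import Function using (id; const; _∘_; _↔_; Inverse; _⇔_; mk⇔; Equivalence)
open import Function.Construct.Identity using (↔-id; ⇔-id)
open import Relation.Nullary using (Dec; yes; no; ¬_; ¬?; contradiction)
open import Relation.Nullary.Decidable using (map′; _×-dec_; _→-dec_)
open import Relation.Unary using (Pred; Decidable; Irrelevant)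
open import Relation.Binary using (DecidableEquality)
open import Relation.Binary.PropositionalEquality
  using (_≡_; _≢_; _≗_; refl; sym; trans; cong; cong₂; subst)
open ≤-Reasoning

private variable
  A : Set
  n : ℕ

countValue : (A → ℕ) → ℕ → List A → ℕ
countValue g c xs = length (filter ((_≟ c) ∘ g) xs)

module _ (g : A → ℕ) where

  countValue-hit : ∀ {c x} xs → g x ≡ c → countValue g c (x ∷ xs) ≡ suc (countValue g c xs)
  countValue-hit {c} xs gx≡c = cong length (filter-accept ((_≟ c) ∘ g) {xs = xs} gx≡c)

  countValue-miss : ∀ {c x} xs → g x ≢ c → countValue g c (x ∷ xs) ≡ countValue g c xs
  countValue-miss {c} xs gx≢c = cong length (filter-reject ((_≟ c) ∘ g) {xs = xs} gx≢c)

  length≤sum+countValue-0 : ∀ xs → length xs ≤ sum (map g xs) + countValue g 0 xs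
  length≤sum+countValue-0 [] = z≤n
  length≤sum+countValue-0 (x ∷ xs) with g x ≟ 0
  ... | yes gx≡0 = begin
    suc (length xs)                                ≤⟨ s≤s (length≤sum+countValue-0 xs) ⟩
    suc (sum (map g xs) + countValue g 0 xs)       ≡⟨ +-suc _ _ ⟨
    sum (map g xs) + suc (countValue g 0 xs)       ≡⟨ cong₂ _+_ (cong (_+ sum (map g xs)) gx≡0)
                                                            (countValue-hit xs gx≡0) ⟨
    sum (map g (x ∷ xs)) + countValue g 0 (x ∷ xs) ∎
  ... | no gx≢0 = begin
    1 + length xs                                  ≤⟨ +-mono-≤ (n≢0⇒n>0 gx≢0)
                                                               (length≤sum+countValue-0 xs) ⟩
    g x + (sum (map g xs) + countValue g 0 xs)     ≡⟨ +-assoc (g x) _ _ ⟨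
    sum (map g (x ∷ xs)) + countValue g 0 xs       ≡⟨ cong (sum (map g (x ∷ xs)) +_)
                                                           (countValue-miss xs gx≢0) ⟨
    sum (map g (x ∷ xs)) + countValue g 0 (x ∷ xs) ∎

  *-countValue≤sum : ∀ c xs → c * countValue g c xs ≤ sum (map g xs)
  *-countValue≤sum c [] = ≤-reflexive (*-zeroʳ c)
  *-countValue≤sum c (x ∷ xs) with g x ≟ c
  ... | yes gx≡c = begin
    c * countValue g c (x ∷ xs)   ≡⟨ cong (c *_) (countValue-hit xs gx≡c) ⟩
    c * suc (countValue g c xs)   ≡⟨ *-suc c _ ⟩
    c + c * countValue g c xs     ≤⟨ +-mono-≤ (≤-reflexive (sym gx≡c)) (*-countValue≤sum c xs) ⟩
    sum (map g (x ∷ xs))          ∎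
  ... | no gx≢c = begin
    c * countValue g c (x ∷ xs)   ≡⟨ cong (c *_) (countValue-miss xs gx≢c) ⟩
    c * countValue g c xs         ≤⟨ *-countValue≤sum c xs ⟩
    sum (map g xs)                ≤⟨ m≤n+m _ (g x) ⟩
    sum (map g (x ∷ xs))          ∎

  sum-map-≤ : ∀ {c} → (∀ x → g x ≤ c) → ∀ xs → sum (map g xs) ≤ length xs * c
  sum-map-≤ g≤c [] = z≤n
  sum-map-≤ g≤c (x ∷ xs) = +-mono-≤ (g≤c x) (sum-map-≤ g≤c xs)

  sum-map-unique-≡ : ∀ {xs ys} → Unique xs → Unique ys → (∀ {x} → x ∈ xs ⇔ x ∈ ys) →
                     sum (map g xs) ≡ sum (map g ys)
  sum-map-unique-≡ uxs uys xs≈ys =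
    sum-↭ (Permutation.map⁺ g (∼bag⇒↭ (unique∧set⇒bag uxs uys xs≈ys)))

∣p∪q∣≤∣p∣+∣q∣ : ∀ (p q : Subset n) → ∣ p ∪ q ∣ ≤ ∣ p ∣ + ∣ q ∣
∣p∪q∣≤∣p∣+∣q∣ [] [] = z≤n
∣p∪q∣≤∣p∣+∣q∣ (outside ∷ p) (outside ∷ q) = ∣p∪q∣≤∣p∣+∣q∣ p q
∣p∪q∣≤∣p∣+∣q∣ (outside ∷ p) (inside ∷ q) =
  ≤-trans (s≤s (∣p∪q∣≤∣p∣+∣q∣ p q)) (≤-reflexive (sym (+-suc ∣ p ∣ ∣ q ∣)))
∣p∪q∣≤∣p∣+∣q∣ (inside ∷ p) (s ∷ q) =
  s≤s (≤-trans (∣p∪q∣≤∣p∣+∣q∣ p q) (+-monoʳ-≤ ∣ p ∣ (∣p∣≤∣x∷p∣ s q)))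

∣⋃ps∣≤sum∣ps∣ : ∀ (ps : List (Subset n)) → ∣ ⋃ ps ∣ ≤ sum (map ∣_∣ ps)
∣⋃ps∣≤sum∣ps∣ {n} [] = ≤-reflexive (∣⊥∣≡0 n)
∣⋃ps∣≤sum∣ps∣ (p ∷ ps) =
  ≤-trans (∣p∪q∣≤∣p∣+∣q∣ p (⋃ ps)) (+-monoʳ-≤ ∣ p ∣ (∣⋃ps∣≤sum∣ps∣ ps))

p⊆⋃ps : ∀ {p} {ps : List (Subset n)} → p ∈ ps → p ⊆ ⋃ ps
p⊆⋃ps {ps = q ∷ ps} (here refl) = p⊆p∪q (⋃ ps)
p⊆⋃ps {ps = q ∷ ps} (there p∈ps) = ⊆-trans (p⊆⋃ps p∈ps) (q⊆p∪q q (⋃ ps))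

unique⇒length≤∣p∣ : ∀ {p : Subset n} {xs} → Unique xs → All (_∈ˢ p) xs → length xs ≤ ∣ p ∣
unique⇒length≤∣p∣ [] [] = z≤n
unique⇒length≤∣p∣ {p = p} {x ∷ xs} (x∉xs ∷ uxs) (x∈p ∷ xs⊆p) =
  ≤-trans (s≤s (unique⇒length≤∣p∣ uxs xs⊆p-x)) (x∈p⇒∣p-x∣<∣p∣ x∈p)
  where
  xs⊆p-x : All (_∈ˢ p - x) xs
  xs⊆p-x = All.zipWith (λ (x≢y , y∈p) → x∈p∧x≢y⇒x∈p-y y∈p (x≢y ∘ sym)) (x∉xs , xs⊆p)

⊆-ofSize : ∀ {k} (p : Subset n) → ∣ p ∣ ≤ k → k ≤ n → ∃ λ q → p ⊆ q × ∣ q ∣ ≡ k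
⊆-ofSize [] z≤n z≤n = [] , id , refl
⊆-ofSize (inside ∷ p) (s≤s ∣p∣≤k) (s≤s k≤n) with ⊆-ofSize p ∣p∣≤k k≤n
... | q , p⊆q , ∣q∣≡k = inside ∷ q , s⊆s p⊆q , cong suc ∣q∣≡k
⊆-ofSize {suc n} {k} (outside ∷ p) ∣p∣≤k k≤1+n with k ≤? n
... | yes k≤n = let q , p⊆q , ∣q∣≡k = ⊆-ofSize p ∣p∣≤k k≤n in outside ∷ q , s⊆s p⊆q , ∣q∣≡k
... | no k≰n = ⊤ , ⊆⊤ , trans (∣⊤∣≡n (suc n)) (≤-antisym (≰⇒> k≰n) k≤1+n)

allSubsets : ∀ n → List (Subset n)
allSubsets zero = [] ∷ []
allSubsets (suc n) = cartesianProductWith _∷_ (inside ∷ outside ∷ []) (allSubsets n)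

∈-allSubsets : ∀ (p : Subset n) → p ∈ allSubsets n
∈-allSubsets [] = here refl
∈-allSubsets (s ∷ p) =
  ∈-cartesianProductWith⁺ _∷_ {xs = inside ∷ outside ∷ []} (∈-sides s) (∈-allSubsets p)
  where
  ∈-sides : ∀ s → s ∈ inside ∷ outside ∷ []
  ∈-sides inside = here refl
  ∈-sides outside = there (here refl)

allSubsets-unique : ∀ n → Unique (allSubsets n)
allSubsets-unique zero = [] ∷ []
allSubsets-unique (suc n) = cartesianProductWith⁺ {xs = inside ∷ outside ∷ []} _∷_ ∷-injective
                                                  (((λ ()) ∷ []) ∷ [] ∷ []) (allSubsets-unique n)

module _ {P : Pred A 0ℓ} (P? : Decidable P) where

  filterΣ : List A → List (Σ A P)
  filterΣ [] = []
  filterΣ (x ∷ xs) with P? x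
  ... | yes px = (x , px) ∷ filterΣ xs
  ... | no _ = filterΣ xs

  map-proj₁-filterΣ : ∀ xs → map proj₁ (filterΣ xs) ≡ filter P? xs
  map-proj₁-filterΣ [] = refl
  map-proj₁-filterΣ (x ∷ xs) with P? x
  ... | yes _ = cong (x ∷_) (map-proj₁-filterΣ xs)
  ... | no _ = map-proj₁-filterΣ xs

  filterΣ-unique : ∀ {xs} → Unique xs → Unique (filterΣ xs)
  filterΣ-unique {xs} uxs = map⁻ (subst Unique (sym (map-proj₁-filterΣ xs)) (filter⁺ P? uxs))

  ∈-filterΣ : Irrelevant P → ∀ {xs} (t : Σ A P) → proj₁ t ∈ xs → t ∈ filterΣ xs
  ∈-filterΣ P-irr {x ∷ xs} t t∈xs with P? x | t∈xs
  ... | yes px | here refl = here (cong (x ,_) (P-irr (proj₂ t) px))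
  ... | yes _  | there t∈xs′ = there (∈-filterΣ P-irr t t∈xs′)
  ... | no ¬px | here refl = contradiction (proj₂ t) ¬px
  ... | no _   | there t∈xs′ = ∈-filterΣ P-irr t t∈xs′

module _ (G : Graph) where
  open Graph G using (V; _≟V_; adj?; verts; verts-complete; verts-unique)

  CommonClosedNeighbour : List V → Set
  CommonClosedNeighbour vs = ∃ λ v → All (InClosedNbhd G v) vs

  reachable-in-closedNbhd : ∀ {v u} → InClosedNbhd G v u → Reachable G v u
  reachable-in-closedNbhd (inj₁ refl) = here
  reachable-in-closedNbhd (inj₂ v-u) = step v-u here

  connected-if-pairs-share-closedNbhd : (∀ u v → CommonClosedNeighbour (u ∷ v ∷ [])) → Connected G
  connected-if-pairs-share-closedNbhd common u v with common u v
  ... | w , inj₁ refl ∷ w~v ∷ [] = reachable-in-closedNbhd w~v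
  ... | w , inj₂ w-u ∷ w~v ∷ [] = step (Graph.sym G w-u) (reachable-in-closedNbhd w~v)

  pair-isTwoNeighbourPacking : ∀ {a b} → a ≢ b → IsTwoNeighbourPacking G (a ∷ b ∷ [])
  pair-isTwoNeighbourPacking {a} {b} a≢b =
    ((a≢b ∷ []) ∷ [] ∷ []) , λ v → length-filter (inClosedNbhd? G v) (a ∷ b ∷ [])

  twoNeighbourPacking-length≤2 : (∀ a b c → CommonClosedNeighbour (a ∷ b ∷ c ∷ [])) →
                                 ∀ {A} → IsTwoNeighbourPacking G A → length A ≤ 2
  twoNeighbourPacking-length≤2 common {[]} _ = z≤n
  twoNeighbourPacking-length≤2 common {a ∷ []} _ = s≤s z≤n
  twoNeighbourPacking-length≤2 common {a ∷ b ∷ []} _ = s≤s (s≤s z≤n)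
  twoNeighbourPacking-length≤2 common {a ∷ b ∷ c ∷ A} (_ , bounded) with common a b c
  ... | v , v~a ∷ v~b ∷ v~c ∷ [] = contradiction (bounded v) (<⇒≱ three≤)
    where
    three≤ : 3 ≤ length (filter (inClosedNbhd? G v) (a ∷ b ∷ c ∷ A))
    three≤ rewrite filter-accept (inClosedNbhd? G v) {xs = b ∷ c ∷ A} v~a
                 | filter-accept (inClosedNbhd? G v) {xs = c ∷ A} v~b
                 | filter-accept (inClosedNbhd? G v) {xs = A} v~c = s≤s (s≤s (s≤s z≤n))

  twoNeighbourPackingNumber≡2 : ∀ {a b} → a ≢ b →
                                (∀ a b c → CommonClosedNeighbour (a ∷ b ∷ c ∷ [])) →
                                IsTwoNeighbourPackingNumber G 2
  twoNeighbourPackingNumber≡2 a≢b common =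
    (_ , pair-isTwoNeighbourPacking a≢b , refl) , λ A → twoNeighbourPacking-length≤2 common

  weight-≡-sum : ∀ {xs} → Unique xs → (∀ v → v ∈ xs) → (f : V → ℕ) → weight G f ≡ sum (map f xs)
  weight-≡-sum uxs complete f =
    sum-map-unique-≡ f verts-unique uxs (mk⇔ (λ _ → complete _) (λ _ → verts-complete _))

  private
    ∀? : {P : V → Set} → (∀ v → Dec (P v)) → Dec (∀ v → P v)
    ∀? P? = map′ (λ all v → All.lookup all (verts-complete v))
                 (λ p → All.tabulate (λ {v} _ → p v))
                 (all? P? verts)

    ∃? : {P : V → Set} → (∀ v → Dec (P v)) → Dec (∃ P)
    ∃? P? = map′ satisfied (λ (v , pv) → lose (verts-complete v) pv) (any? P? verts)

  isRDF? : (f : V → ℕ) → Dec (IsRDF G f)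
  isRDF? f = ∀? (λ v → f v ≤? 2)
       ×-dec ∀? (λ v → (f v ≟ 0) →-dec ∃? (λ u → adj? v u ×-dec (f u ≟ 2)))

  IsRDF-resp-≗ : ∀ {f g} → f ≗ g → IsRDF G f → IsRDF G g
  IsRDF-resp-≗ f≗g (f≤2 , dominated) =
    (λ v → subst (_≤ 2) (f≗g v) (f≤2 v)) ,
    λ v gv≡0 → let u , v-u , fu≡2 = dominated v (trans (f≗g v) gv≡0)
               in u , v-u , trans (sym (f≗g u)) fu≡2

  update : V → ℕ → (V → ℕ) → V → ℕ
  update v c g u with u ≟V v
  ... | yes _ = c
  ... | no _ = g u

  assignments : List V → List (V → ℕ)
  assignments [] = const 0 ∷ []
  assignments (v ∷ vs) = cartesianProductWith (update v) (upTo 3) (assignments vs)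

  assignments-cover : (f : V → ℕ) → (∀ v → f v ≤ 2) →
                      ∀ vs → ∃ λ g → g ∈ assignments vs × (∀ {u} → u ∈ vs → g u ≡ f u)
  assignments-cover f f≤2 [] = const 0 , here refl , λ ()
  assignments-cover f f≤2 (v ∷ vs) with assignments-cover f f≤2 vs
  ... | g , g∈ , g≈f =
    update v (f v) g , ∈-cartesianProductWith⁺ (update v) (∈-upTo⁺ (s≤s (f≤2 v))) g∈ , agree
    where
    agree : ∀ {u} → u ∈ v ∷ vs → update v (f v) g u ≡ f u
    agree {u} u∈ with u ≟V v
    agree u∈ | yes refl = refl
    agree (here u≡v) | no u≢v = contradiction u≡v u≢v
    agree (there u∈vs) | no _ = g≈f u∈vs

  romanDominationNumber-exists : ∃ (IsRomanDominationNumber G)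
  romanDominationNumber-exists = weight G best , (best , best-isRDF , refl) , best-minimal
    where
    two : V → ℕ
    two = const 2

    two-isRDF : IsRDF G two
    two-isRDF = (λ _ → s≤s (s≤s z≤n)) , λ _ ()

    candidates : List (V → ℕ)
    candidates = filter isRDF? (assignments verts)

    best : V → ℕ
    best = argmin (weight G) two candidates

    best-isRDF : IsRDF G best
    best-isRDF = argmin-all (weight G) two-isRDF (all-filter isRDF? (assignments verts))

    best-minimal : ∀ f → IsRDF G f → weight G best ≤ weight G f
    best-minimal f f-isRDF with assignments-cover f (proj₁ f-isRDF) verts
    ... | g , g∈ , g≈f = subst (weight G best ≤_) (cong sum (map-cong g≗f verts))
                           (All.lookup (f[argmin]≤f[xs] two candidates) g∈candidates)
      where
      g≗f : g ≗ f
      g≗f v = g≈f (verts-complete v)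

      g∈candidates : g ∈ candidates
      g∈candidates = ∈-filter⁺ isRDF? g∈ (IsRDF-resp-≗ (sym ∘ g≗f) f-isRDF)

module GraphIsomorphism (G H : Graph) (φ : Graph.V G ↔ Graph.V H)
    (adj⇔ : ∀ u v → Graph.Adj G u v ⇔ Graph.Adj H (Inverse.to φ u) (Inverse.to φ v)) where
  open Inverse φ using (to; from; strictlyInverseˡ; strictlyInverseʳ)
  open Graph using (Adj; verts; verts-complete; verts-unique)

  from-injective : ∀ {x y} → from x ≡ from y → x ≡ y
  from-injective {x} {y} fx≡fy =
    trans (sym (strictlyInverseˡ x)) (trans (cong to fx≡fy) (strictlyInverseˡ y))

  adj-from : ∀ {x u} → Adj H x (to u) → Adj G (from x) u
  adj-from {x} {u} x-u = Equivalence.from (adj⇔ (from x) u)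
                           (subst (λ y → Adj H y (to u)) (sym (strictlyInverseˡ x)) x-u)

  adj-to : ∀ {u v} → Adj G (from u) v → Adj H u (to v)
  adj-to {u} {v} u-v = subst (λ y → Adj H y (to v)) (strictlyInverseˡ u)
                         (Equivalence.to (adj⇔ (from u) v) u-v)

  commonClosedNeighbour-from : ∀ vs → CommonClosedNeighbour H (map to vs) →
                               CommonClosedNeighbour G vs
  commonClosedNeighbour-from vs (x , x~vs) = from x , All.map closedNbhd-from (All-map⁻ x~vs)
    where
    closedNbhd-from : ∀ {u} → InClosedNbhd H x (to u) → InClosedNbhd G (from x) u
    closedNbhd-from {u} (inj₁ tu≡x) = inj₁ (trans (sym (strictlyInverseʳ u)) (cong from tu≡x))
    closedNbhd-from (inj₂ x-tu) = inj₂ (adj-from x-tu)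

  isRDF-from : ∀ {f} → IsRDF G f → IsRDF H (f ∘ from)
  isRDF-from {f} (f≤2 , dominated) = f≤2 ∘ from , λ x fx≡0 →
    let u , x-u , fu≡2 = dominated (from x) fx≡0
    in to u , adj-to x-u , trans (cong f (strictlyInverseʳ u)) fu≡2

  weight-from : ∀ f → weight G f ≡ weight H (f ∘ from)
  weight-from f = trans (weight-≡-sum G (map⁺ from-injective (verts-unique H)) ∈-from-verts f)
                        (cong sum (sym (map-∘ (verts H))))
    where
    ∈-from-verts : ∀ v → v ∈ map from (verts H)
    ∈-from-verts v = subst (_∈ map from (verts H)) (strictlyInverseʳ v)
                           (∈-map⁺ from (verts-complete H (to v)))

_≟Subset_ : DecidableEquality (Subset n)
_≟Subset_ = ≡-dec _≟Bool_

Triple-≡ : ∀ {s t : Triple n} → proj₁ s ≡ proj₁ t → s ≡ t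
Triple-≡ {s = p , ∣p∣≡3} {.p , ∣p∣≡3′} refl = cong (p ,_) (≡-irrelevant ∣p∣≡3 ∣p∣≡3′)

_≟Triple_ : DecidableEquality (Triple n)
s ≟Triple t = map′ Triple-≡ (cong proj₁) (proj₁ s ≟Subset proj₁ t)

allTriples : ∀ n → List (Triple n)
allTriples n = filterΣ (λ s → ∣ s ∣ ≟ 3) (allSubsets n)

∈-allTriples : ∀ (t : Triple n) → t ∈ allTriples n
∈-allTriples t = ∈-filterΣ _ ≡-irrelevant t (∈-allSubsets (proj₁ t))

allTriples-unique : ∀ n → Unique (allTriples n)
allTriples-unique n = filterΣ-unique _ (allSubsets-unique n)

GnAdj? : ∀ (u v : GnV n) → Dec (GnAdj n u v)
GnAdj? (inj₁ w) (inj₁ w′) = no λ ()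
GnAdj? (inj₁ w) (inj₂ t) = w ∈? proj₁ t
GnAdj? (inj₂ t) (inj₁ w) = w ∈? proj₁ t
GnAdj? (inj₂ s) (inj₂ t) = ¬? (proj₁ s ≟Subset proj₁ t)

GnAdj-sym : ∀ {u v : GnV n} → GnAdj n u v → GnAdj n v u
GnAdj-sym {u = inj₁ _} {inj₂ _} w∈t = w∈t
GnAdj-sym {u = inj₂ _} {inj₁ _} w∈t = w∈t
GnAdj-sym {u = inj₂ _} {inj₂ _} s≢t = s≢t ∘ sym

GnAdj-irrefl : ∀ {v : GnV n} → ¬ GnAdj n v v
GnAdj-irrefl {v = inj₂ _} t≢t = t≢t refl

GnVerts : ∀ n → List (GnV n)
GnVerts n = map inj₁ (allFin n) ++ map inj₂ (allTriples n)

∈-GnVerts : ∀ (v : GnV n) → v ∈ GnVerts n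
∈-GnVerts (inj₁ w) = ∈-++⁺ˡ (∈-map⁺ inj₁ (∈-allFin w))
∈-GnVerts {n} (inj₂ t) = ∈-++⁺ʳ (map inj₁ (allFin n)) (∈-map⁺ inj₂ (∈-allTriples t))

GnVerts-unique : ∀ n → Unique (GnVerts n)
GnVerts-unique n =
  ++⁺ (map⁺ inj₁-injective (allFin⁺ n)) (map⁺ inj₂-injective (allTriples-unique n)) disjoint
  where
  disjoint : ∀ {v} → ¬ (v ∈ map inj₁ (allFin n) × v ∈ map inj₂ (allTriples n))
  disjoint (v∈W , v∈K) with ∈-map⁻ inj₁ v∈W | ∈-map⁻ inj₂ v∈K
  ... | _ , _ , refl | _ , _ , ()

Gn : ℕ → Graph
Gn n = record
  { V = GnV n
  ; _≟V_ = ≡-dec-⊎ Fin._≟_ _≟Triple_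
  ; Adj = GnAdj n
  ; adj? = GnAdj?
  ; sym = GnAdj-sym
  ; irrefl = GnAdj-irrefl
  ; verts = GnVerts n
  ; verts-complete = ∈-GnVerts
  ; verts-unique = GnVerts-unique n
  }

Gn-distinctVertices : 3 ≤ n → ∃ λ (u : GnV n) → ∃ λ v → u ≢ v
Gn-distinctVertices (s≤s (s≤s (s≤s _))) = inj₁ Fin.zero , inj₁ (Fin.suc Fin.zero) , λ ()

wVertices : GnV n → Subset n
wVertices (inj₁ w) = ⁅ w ⁆
wVertices (inj₂ _) = ⊥

∣wVertices∣≤1 : ∀ (v : GnV n) → ∣ wVertices v ∣ ≤ 1
∣wVertices∣≤1 (inj₁ w) = ≤-reflexive (∣⁅x⁆∣≡1 w)
∣wVertices∣≤1 {n} (inj₂ _) = ≤-trans (≤-reflexive (∣⊥∣≡0 n)) z≤n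

inClosedNbhd-triple : ∀ (t : Triple n) v → wVertices v ⊆ proj₁ t → InClosedNbhd (Gn n) (inj₂ t) v
inClosedNbhd-triple t (inj₁ w) w⊆t = inj₂ (w⊆t (x∈⁅x⁆ w))
inClosedNbhd-triple t (inj₂ s) _ with proj₁ s ≟Subset proj₁ t
... | yes s≡t = inj₁ (cong inj₂ (Triple-≡ s≡t))
... | no s≢t = inj₂ (s≢t ∘ sym)

Gn-commonClosedNeighbour : 3 ≤ n → ∀ vs → length vs ≤ 3 → CommonClosedNeighbour (Gn n) vs
Gn-commonClosedNeighbour 3≤n vs len≤3 with ⊆-ofSize (⋃ (map wVertices vs)) ∣support∣≤3 3≤n
  where
  ∣support∣≤3 : ∣ ⋃ (map wVertices vs) ∣ ≤ 3
  ∣support∣≤3 = begin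
    ∣ ⋃ (map wVertices vs) ∣         ≤⟨ ∣⋃ps∣≤sum∣ps∣ (map wVertices vs) ⟩
    sum (map ∣_∣ (map wVertices vs)) ≡⟨ cong sum (map-∘ vs) ⟨
    sum (map (∣_∣ ∘ wVertices) vs)   ≤⟨ sum-map-≤ (∣_∣ ∘ wVertices) ∣wVertices∣≤1 vs ⟩
    length vs * 1                   ≡⟨ *-identityʳ (length vs) ⟩
    length vs                       ≤⟨ len≤3 ⟩
    3                               ∎
... | q , support⊆q , ∣q∣≡3 = inj₂ (q , ∣q∣≡3) , All.tabulate λ v∈vs →
  inClosedNbhd-triple _ _ (⊆-trans (p⊆⋃ps (∈-map⁺ wVertices v∈vs)) support⊆q)

Gn-connected : 3 ≤ n → Connected (Gn n)
Gn-connected 3≤n = connected-if-pairs-share-closedNbhd (Gn _) λ u v →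
  Gn-commonClosedNeighbour 3≤n (u ∷ v ∷ []) (s≤s (s≤s z≤n))

weight-Gn : ∀ (F : GnV n → ℕ) →
            weight (Gn n) F ≡ sum (map (F ∘ inj₁) (allFin n)) + sum (map (F ∘ inj₂) (allTriples n))
weight-Gn {n} F = begin-equality
  sum (map F (map inj₁ (allFin n) ++ map inj₂ (allTriples n)))
    ≡⟨ cong sum (map-++ F (map inj₁ (allFin n)) _) ⟩
  sum (map F (map inj₁ (allFin n)) ++ map F (map inj₂ (allTriples n)))
    ≡⟨ sum-++ (map F (map inj₁ (allFin n))) _ ⟩
  sum (map F (map inj₁ (allFin n))) + sum (map F (map inj₂ (allTriples n)))
    ≡⟨ cong₂ _+_ (cong sum (map-∘ (allFin n))) (cong sum (map-∘ (allTriples n))) ⟨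
  sum (map (F ∘ inj₁) (allFin n)) + sum (map (F ∘ inj₂) (allTriples n)) ∎

2*n≤3*[a+b] : ∀ {n a b z j} → n ≤ a + z → z ≤ j * 3 → 2 * j ≤ b → 2 * n ≤ 3 * (a + b)
2*n≤3*[a+b] {n} {a} {b} {z} {j} n≤a+z z≤3j 2j≤b = begin
  2 * n               ≤⟨ *-monoʳ-≤ 2 n≤a+z ⟩
  2 * (a + z)         ≡⟨ *-distribˡ-+ 2 a z ⟩
  2 * a + 2 * z       ≤⟨ +-mono-≤ (*-monoˡ-≤ a {2} {3} (s≤s (s≤s z≤n))) (*-monoʳ-≤ 2 z≤3j) ⟩
  3 * a + 2 * (j * 3) ≡⟨ cong (3 * a +_) (trans (*-comm 3 (2 * j)) (*-assoc 2 j 3)) ⟨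
  3 * a + 3 * (2 * j) ≤⟨ +-monoʳ-≤ (3 * a) (*-monoʳ-≤ 3 2j≤b) ⟩
  3 * a + 3 * b       ≡⟨ *-distribˡ-+ 3 a b ⟨
  3 * (a + b)         ∎

module _ {n} (F : GnV n → ℕ) (F-isRDF : IsRDF (Gn n) F) where

  private
    isZero? : (w : Fin n) → Dec (F (inj₁ w) ≡ 0)
    isZero? w = F (inj₁ w) ≟ 0

    twos : List (Triple n)
    twos = filter (λ t → F (inj₂ t) ≟ 2) (allTriples n)

    zero-∈-⋃twos : ∀ {w} → w ∈ filter isZero? (allFin n) → w ∈ˢ ⋃ (map proj₁ twos)
    zero-∈-⋃twos w∈zeros with proj₂ F-isRDF _ (proj₂ (∈-filter⁻ isZero? {xs = allFin n} w∈zeros))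
    ... | inj₂ t , w∈t , Ft≡2 = p⊆⋃ps (∈-map⁺ proj₁ (∈-filter⁺ _ (∈-allTriples t) Ft≡2)) w∈t

  W-zeros≤K-twos*3 : countValue (F ∘ inj₁) 0 (allFin n) ≤ countValue (F ∘ inj₂) 2 (allTriples n) * 3
  W-zeros≤K-twos*3 = begin
    length (filter isZero? (allFin n)) ≤⟨ unique⇒length≤∣p∣ (filter⁺ isZero? (allFin⁺ n))
                                                             (All.tabulate zero-∈-⋃twos) ⟩
    ∣ ⋃ (map proj₁ twos) ∣             ≤⟨ ∣⋃ps∣≤sum∣ps∣ (map proj₁ twos) ⟩
    sum (map ∣_∣ (map proj₁ twos))     ≡⟨ cong sum (map-∘ twos) ⟨
    sum (map (∣_∣ ∘ proj₁) twos)       ≤⟨ sum-map-≤ (∣_∣ ∘ proj₁) (≤-reflexive ∘ proj₂) twos ⟩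
    length twos * 3                    ∎

  Gn-romanBound : 2 * n ≤ 3 * weight (Gn n) F
  Gn-romanBound = subst (λ w → 2 * n ≤ 3 * w) (sym (weight-Gn F))
    (2*n≤3*[a+b] {z = W-zeros} {j = K-twos} n≤a+z W-zeros≤K-twos*3
                 (*-countValue≤sum (F ∘ inj₂) 2 (allTriples n)))
    where
    W-zeros : ℕ
    W-zeros = countValue (F ∘ inj₁) 0 (allFin n)

    K-twos : ℕ
    K-twos = countValue (F ∘ inj₂) 2 (allTriples n)

    n≤a+z : n ≤ sum (map (F ∘ inj₁) (allFin n)) + W-zeros
    n≤a+z = subst (_≤ sum (map (F ∘ inj₁) (allFin n)) + W-zeros) (length-tabulate id)
                  (length≤sum+countValue-0 (F ∘ inj₁) (allFin n))

module _ (n : ℕ) (3≤n : 3 ≤ n) (G : Graph) (φ : Graph.V G ↔ GnV n)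
    (adj⇔ : ∀ u v → Graph.Adj G u v ⇔ GnAdj n (Inverse.to φ u) (Inverse.to φ v)) where
  open GraphIsomorphism G (Gn n) φ adj⇔
  open Inverse φ using (from)

  ≅Gn-twoNeighbourPackingNumber : IsTwoNeighbourPackingNumber G 2
  ≅Gn-twoNeighbourPackingNumber =
    let _ , _ , u≢v = Gn-distinctVertices 3≤n
    in twoNeighbourPackingNumber≡2 G (u≢v ∘ from-injective) λ a b c →
         commonClosedNeighbour-from (a ∷ b ∷ c ∷ []) (Gn-commonClosedNeighbour 3≤n _ ≤-refl)

  ≅Gn-romanBound : ∀ r → IsRomanDominationNumber G r → 2 * n ≤ 3 * r
  ≅Gn-romanBound r ((f , f-isRDF , wf≡r) , _) =
    subst (λ w → 2 * n ≤ 3 * w) (trans (sym (weight-from f)) wf≡r)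
          (Gn-romanBound (f ∘ from) (isRDF-from f-isRDF))

2*[3*[1+c]]≤3*r⇒c*2<r : ∀ c r → 2 * (3 * suc c) ≤ 3 * r → c * 2 < r
2*[3*[1+c]]≤3*r⇒c*2<r c r 6[1+c]≤3r = begin-strict
  c * 2       ≡⟨ *-comm c 2 ⟩
  2 * c       <⟨ *-monoʳ-< 2 (n<1+n c) ⟩
  2 * suc c   ≤⟨ *-cancelˡ-≤ 3 (subst (_≤ 3 * r) regroup 6[1+c]≤3r) ⟩
  r           ∎
  where
  regroup : 2 * (3 * suc c) ≡ 3 * (2 * suc c)
  regroup = trans (sym (*-assoc 2 3 (suc c))) (*-assoc 3 2 (suc c))

romanRatio-unbounded : (c : ℕ) → ∃ λ (G : Graph) → Connected G × ∃ λ r → ∃ λ p →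
                       IsRomanDominationNumber G r × IsTwoNeighbourPackingNumber G p × c * p < r
romanRatio-unbounded c =
  Gn m , Gn-connected 3≤m , r , 2 , r-isγR ,
  ≅Gn-twoNeighbourPackingNumber m 3≤m (Gn m) (↔-id _) adj⇔ ,
  2*[3*[1+c]]≤3*r⇒c*2<r c r (≅Gn-romanBound m 3≤m (Gn m) (↔-id _) adj⇔ r r-isγR)
  where
  m : ℕ
  m = 3 * suc c

  3≤m : 3 ≤ m
  3≤m = m≤m*n 3 (suc c)

  adj⇔ : ∀ u v → GnAdj m u v ⇔ GnAdj m u v
  adj⇔ u v = ⇔-id (GnAdj m u v)

  r : ℕ
  r = proj₁ (romanDominationNumber-exists (Gn m))

  r-isγR : IsRomanDominationNumber (Gn m) r
  r-isγR = proj₂ (romanDominationNumber-exists (Gn m))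

mainTheorem9 :
  ((n : ℕ) → 3 ≤ n → (G : Graph) → (φ : Graph.V G ↔ GnV n)
    → (∀ u v → Graph.Adj G u v ⇔ GnAdj n (Inverse.to φ u) (Inverse.to φ v))
    → IsTwoNeighbourPackingNumber G 2
      × (∀ r → IsRomanDominationNumber G r → 2 * n ≤ 3 * r))
  × ((c : ℕ) → ∃ λ (G : Graph) → Connected G × ∃ λ r → ∃ λ p →
      IsRomanDominationNumber G r × IsTwoNeighbourPackingNumber G p × c * p < r)
mainTheorem9 =
  (λ n 3≤n G φ adj⇔ → ≅Gn-twoNeighbourPackingNumber n 3≤n G φ adj⇔
                    , ≅Gn-romanBound n 3≤n G φ adj⇔)
  , romanRatio-unbounded
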